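{- Let $\mathcal T=\{(*_1),\dots,(*_t)\}$ be a $2$-good, $2$-full collection of independent difference equalities which minimally implies a difference equality $(*)$, and let $\xi_1,\dots,\xi_t\in\{\pm1\}$ satisfy $*=\xi_1{*_1}+\cdots+\xi_t{*_t}$ (contents). Let $t'\le t$ be such that $\mathcal T'=\{(*_1),\dots,(*_{t'})\}$ is $2$-full. Then the equation $(*')$ with content $*'=\xi_1{*_1}+\cdots+\xi_{t'}{*_{t'}}$ is a difference equality.
   Context: All linear equations are over $\mathbb Q$ in variables $x_1,\dots,x_k$, considered up to rearrangement but not scaling; the content of an equation is an expression $*$ with the equation reading $*=0$ (for $(*_j)$ the content is written $*_j$). Equations are independent if their contents are linearly independent; a collection implies an equation if its content is a $\mathbb Q$-linear combination of the contents of the collection, and minimally implies it if it implies it but no proper subset does. An equation contains a variable if its coefficient is nonzero. A difference equality is a nontrivial equation $x_{i_1}-x_{i_2}=x_{i_3}-x_{i_4}$ ($i_1,\dots,i_4\in[k]$ not necessarily distinct). A collection is valid if it does not imply $x_a=x_b$ for $a\ne b$; collinearity-free if it implies no equation containing exactly three variables; $2$-light if for every $s\ge1$ any $s$ independent equations it implies together contain at least $2s+1$ variables; $2$-good if valid, collinearity-free and $2$-light. A collection of $s$ linearly independent difference equalities is $2$-full if the equations together contain exactly $2s+1$ variables. -}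

module Defs where

open import Data.Nat as ℕ using (ℕ; zero; suc)
open import Data.Fin as Fin using (Fin; zero; suc)
open import Data.Fin.Properties as FinP using ()
open import Data.Rational using (ℚ; 0ℚ; 1ℚ; _+_; _*_; -_; _-_)
open import Data.Rational.Properties as ℚP using ()
open import Data.Bool using (Bool; true; false; not; _∨_; if_then_else_)
open import Data.Product using (Σ; ∃; _×_; _,_)
open import Relation.Nullary using (¬_; does)
open import Relation.Binary.PropositionalEquality using (_≡_; _≢_)

-- Content of a linear equation over ℚ in variables x_1..x_k:
-- the coefficient vector of the linear form (equation reads content = 0).
Form : ℕ → Set
Form k = Fin k → ℚ

_≈_ : ∀ {k} → Form k → Form k → Set
f ≈ g = ∀ j → f j ≡ g j

zeroF : ∀ {k} → Form k
zeroF _ = 0ℚ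

var : ∀ {k} → Fin k → Form k
var i j = if does (i FinP.≟ j) then 1ℚ else 0ℚ

_⊕_ : ∀ {k} → Form k → Form k → Form k
(f ⊕ g) j = f j + g j

_⊖_ : ∀ {k} → Form k → Form k → Form k
(f ⊖ g) j = f j - g j

sumFin : ∀ {t} → (Fin t → ℚ) → ℚ
sumFin {zero} f = 0ℚ
sumFin {suc t} f = f zero + sumFin (λ i → f (suc i))

lincomb : ∀ {k t} → (Fin t → ℚ) → (Fin t → Form k) → Form k
lincomb l c j = sumFin (λ i → l i * c i j)

LinIndep : ∀ {k t} → (Fin t → Form k) → Set
LinIndep c = ∀ l → lincomb l c ≈ zeroF → ∀ i → l i ≡ 0ℚ

Implies : ∀ {k t} → (Fin t → Form k) → Form k → Set
Implies c e = ∃ λ l → lincomb l c ≈ e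

ImpliesSub : ∀ {k t} → (Fin t → Form k) → (Fin t → Bool) → Form k → Set
ImpliesSub c S e = ∃ λ l → (∀ i → S i ≡ false → l i ≡ 0ℚ) × (lincomb l c ≈ e)

MinImplies : ∀ {k t} → (Fin t → Form k) → Form k → Set
MinImplies {k} {t} c e = Implies c e ×
  (∀ (S : Fin t → Bool) → (∃ λ i → S i ≡ false) → ¬ ImpliesSub c S e)

Contains : ∀ {k} → Form k → Fin k → Set
Contains e j = e j ≢ 0ℚ

containsB : ∀ {k} → Form k → Fin k → Bool
containsB e j = not (does (e j ℚP.≟ 0ℚ))

anyFin : ∀ {t} → (Fin t → Bool) → Bool
anyFin {zero} f = false
anyFin {suc t} f = f zero ∨ anyFin (λ i → f (suc i))

countFin : ∀ {k} → (Fin k → Bool) → ℕ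
countFin {zero} f = 0
countFin {suc k} f = (if f zero then 1 else 0) ℕ.+ countFin (λ i → f (suc i))

numVars : ∀ {k t} → (Fin t → Form k) → ℕ
numVars c = countFin (λ j → anyFin (λ i → containsB (c i) j))

numVars1 : ∀ {k} → Form k → ℕ
numVars1 e = countFin (containsB e)

DiffEq : ∀ {k} → Form k → Set
DiffEq {k} e = (¬ (e ≈ zeroF)) ×
  (∃ λ (i₁ : Fin k) → ∃ λ i₂ → ∃ λ i₃ → ∃ λ i₄ →
     e ≈ ((var i₁ ⊖ var i₂) ⊖ (var i₃ ⊖ var i₄)))

Valid : ∀ {k t} → (Fin t → Form k) → Set
Valid {k} c = ∀ (a b : Fin k) → a ≢ b → ¬ Implies c (var a ⊖ var b)

CollinearityFree : ∀ {k t} → (Fin t → Form k) → Set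
CollinearityFree {k} c = ∀ (e : Form k) → Implies c e → numVars1 e ≢ 3

TwoLight : ∀ {k t} → (Fin t → Form k) → Set
TwoLight {k} c = ∀ (s : ℕ) → 1 ℕ.≤ s → (d : Fin s → Form k) → LinIndep d →
  (∀ i → Implies c (d i)) → 2 ℕ.* s ℕ.+ 1 ℕ.≤ numVars d

TwoGood : ∀ {k t} → (Fin t → Form k) → Set
TwoGood c = Valid c × CollinearityFree c × TwoLight c

TwoFull : ∀ {k t} → (Fin t → Form k) → Set
TwoFull {k} {t} c = (∀ i → DiffEq (c i)) × LinIndep c × numVars c ≡ 2 ℕ.* t ℕ.+ 1

{-# OPTIONS --safe #-}
module Submission where

-- Difference equalities are exactly the nonzero integer forms with coefficient sum 0 and
-- ℓ¹-norm at most 4. The partial sum e′ = Σ_{i<t′} ξᵢ Tᵢ is an integer form with sum 0, nonzero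
-- by independence of T′, so only ‖e′‖ ≤ 4 needs proof. Write e = e′ + Σ_{i≥t′} ξᵢ Tᵢ. In every
-- variable |e′ⱼ| ≤ |eⱼ| + Σ_{i≥t′} |Tᵢⱼ|, and in each variable occurring in T but not in T′ the
-- left side is 0 while the right side is at least 2, since 2|xᵢ| ≤ |Σ x| + Σ |x|. By 2-fullness
-- of T and T′ there are 2(t − t′) such variables, so summing gives
-- ‖e′‖ + 4(t − t′) ≤ ‖e‖ + 4(t − t′).

open import Defs
open import Data.Nat using (ℕ; zero; suc; _+_; _*_; _∸_; _≤_; z≤n; s≤s; _<ᵇ_)
import Data.Nat.Properties as ℕP
import Data.Nat.Tactic.RingSolver as ℕSolver
open import Data.Integer as ℤ using (ℤ; +_; -[1+_]; 0ℤ; 1ℤ; -1ℤ; ∣_∣)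
import Data.Integer.Properties as ℤP
import Data.Integer.Tactic.RingSolver as ℤSolver
open import Data.Rational as ℚ using (ℚ; mkℚ; 0ℚ; 1ℚ; -_)
import Data.Rational.Properties as ℚP
open import Data.Rational.Unnormalised using (*≡*)
import Data.Rational.Unnormalised.Properties as ℚᵘP
import Data.Nat.Coprimality as Coprime
open import Data.Fin using (Fin; zero; suc; toℕ; inject≤)
import Data.Fin.Properties as FinP
open import Data.List using (List; []; _∷_; _++_; replicate; map; length)
import Data.List.Properties as ListP
open import Data.Bool using (Bool; true; false; not; _∧_; if_then_else_)
open import Data.Bool.Properties using (¬-not)
open import Data.Product using (∃; _×_; _,_; proj₁; proj₂)
open import Data.Sum using (_⊎_; inj₁; inj₂)
open import Data.Empty using (⊥-elim)
open import Data.Vec.Functional using (removeAt)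
open import Function using (_∘_)
open import Relation.Nullary using (¬_; does; yes; no)
open import Relation.Binary.PropositionalEquality
import Algebra.Properties.CommutativeMonoid.Sum as CommutativeMonoidSum
open import Algebra.Properties.Semiring.Sum ℤP.+-*-semiring using (*-distribˡ-sum)
open import Algebra.Properties.CommutativeSemigroup ℕP.+-commutativeSemigroup using (x∙yz≈y∙xz)

-- mkℚ stores the denominator minus one, so this is z / 1.
fromℤ : ℤ → ℚ
fromℤ z = mkℚ z 0 (Coprime.sym (Coprime.1-coprimeTo _))

fromℤ-injective : ∀ {a b} → fromℤ a ≡ fromℤ b → a ≡ b
fromℤ-injective = cong ℚ.↥_

fromℤ-homo-+ : ∀ a b → fromℤ (a ℤ.+ b) ≡ fromℤ a ℚ.+ fromℤ b
fromℤ-homo-+ a b = ℚP.toℚᵘ-injective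
  (ℚᵘP.≃-trans (*≡* (cross a b)) (ℚᵘP.≃-sym (ℚP.toℚᵘ-homo-+ (fromℤ a) (fromℤ b))))
  where
  cross : ∀ a b → (a ℤ.+ b) ℤ.* 1ℤ ≡ (a ℤ.* 1ℤ ℤ.+ b ℤ.* 1ℤ) ℤ.* 1ℤ
  cross = ℤSolver.solve-∀

fromℤ-homo-* : ∀ a b → fromℤ (a ℤ.* b) ≡ fromℤ a ℚ.* fromℤ b
fromℤ-homo-* a b = ℚP.toℚᵘ-injective
  (ℚᵘP.≃-trans (*≡* refl) (ℚᵘP.≃-sym (ℚP.toℚᵘ-homo-* (fromℤ a) (fromℤ b))))

fromℤ-homo-‿- : ∀ a → fromℤ (ℤ.- a) ≡ - fromℤ a
fromℤ-homo-‿- (+ zero)   = refl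
fromℤ-homo-‿- (+ suc n)  = refl
fromℤ-homo-‿- -[1+ n ]   = refl

fromℤ-homo-− : ∀ a b → fromℤ (a ℤ.- b) ≡ fromℤ a ℚ.- fromℤ b
fromℤ-homo-− a b = trans (fromℤ-homo-+ a (ℤ.- b)) (cong (fromℤ a ℚ.+_) (fromℤ-homo-‿- b))

module ℤΣ = CommutativeMonoidSum ℤP.+-0-commutativeMonoid
module ℕΣ = CommutativeMonoidSum ℕP.+-0-commutativeMonoid
open ℤΣ using () renaming (sum to ∑ℤ)
open ℕΣ using () renaming (sum to ∑ℕ)

sumFin-fromℤ : ∀ {n} {f : Fin n → ℚ} (g : Fin n → ℤ) → (∀ i → f i ≡ fromℤ (g i)) → sumFin f ≡ fromℤ (∑ℤ g)
sumFin-fromℤ {zero}  g f≡g = refl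
sumFin-fromℤ {suc n} g f≡g = trans (cong₂ ℚ._+_ (f≡g zero) (sumFin-fromℤ (g ∘ suc) (f≡g ∘ suc)))
                                   (sym (fromℤ-homo-+ (g zero) (∑ℤ (g ∘ suc))))

∑ℤ-distrib-− : ∀ {n} (f g : Fin n → ℤ) → ∑ℤ (λ i → f i ℤ.- g i) ≡ ∑ℤ f ℤ.- ∑ℤ g
∑ℤ-distrib-− {zero}  f g = refl
∑ℤ-distrib-− {suc n} f g = trans (cong (ℤ._+_ (f zero ℤ.- g zero)) (∑ℤ-distrib-− (f ∘ suc) (g ∘ suc)))
                                 (interchange (f zero) (g zero) _ _)
  where
  interchange : ∀ a b c d → (a ℤ.- b) ℤ.+ (c ℤ.- d) ≡ (a ℤ.+ c) ℤ.- (b ℤ.+ d)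
  interchange = ℤSolver.solve-∀

pos-∑ : ∀ {n} (m : Fin n → ℕ) → ∑ℤ (+_ ∘ m) ≡ + ∑ℕ m
pos-∑ {zero}  m = refl
pos-∑ {suc n} m = cong (ℤ._+_ (+ m zero)) (pos-∑ (m ∘ suc))

∑ℕ-mono-≤ : ∀ {n} {f g : Fin n → ℕ} → (∀ i → f i ≤ g i) → ∑ℕ f ≤ ∑ℕ g
∑ℕ-mono-≤ {zero}  f≤g = z≤n
∑ℕ-mono-≤ {suc n} f≤g = ℕP.+-mono-≤ (f≤g zero) (∑ℕ-mono-≤ (f≤g ∘ suc))

∣i∣≤∣i+j∣+∣j∣ : ∀ i j → ∣ i ∣ ≤ ∣ i ℤ.+ j ∣ + ∣ j ∣
∣i∣≤∣i+j∣+∣j∣ i j = subst (λ x → ∣ x ∣ ≤ ∣ i ℤ.+ j ∣ + ∣ j ∣) (i+j-j≡i i j) (ℤP.∣i-j∣≤∣i∣+∣j∣ (i ℤ.+ j) j)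
  where
  i+j-j≡i : ∀ i j → (i ℤ.+ j) ℤ.- j ≡ i
  i+j-j≡i = ℤSolver.solve-∀

∣∑f∣≤∑∣f∣ : ∀ {n} (f : Fin n → ℤ) → ∣ ∑ℤ f ∣ ≤ ∑ℕ (∣_∣ ∘ f)
∣∑f∣≤∑∣f∣ {zero}  f = z≤n
∣∑f∣≤∑∣f∣ {suc n} f = ℕP.≤-trans (ℤP.∣i+j∣≤∣i∣+∣j∣ (f zero) _) (ℕP.+-monoʳ-≤ ∣ f zero ∣ (∣∑f∣≤∑∣f∣ (f ∘ suc)))

2∣fᵢ∣≤∣∑f∣+∑∣f∣ : ∀ {n} (f : Fin n → ℤ) i → 2 * ∣ f i ∣ ≤ ∣ ∑ℤ f ∣ + ∑ℕ (∣_∣ ∘ f)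
2∣fᵢ∣≤∣∑f∣+∑∣f∣ {suc n} f i = begin
  2 * ∣ f i ∣                        ≡⟨ cong (_+_ ∣ f i ∣) (ℕP.+-identityʳ ∣ f i ∣) ⟩
  ∣ f i ∣ + ∣ f i ∣                  ≤⟨ ℕP.+-monoʳ-≤ ∣ f i ∣ (∣i∣≤∣i+j∣+∣j∣ (f i) R) ⟩
  ∣ f i ∣ + (∣ f i ℤ.+ R ∣ + ∣ R ∣)  ≡⟨ cong (λ x → ∣ f i ∣ + (∣ x ∣ + ∣ R ∣)) (sym (ℤΣ.sum-remove f)) ⟩
  ∣ f i ∣ + (∣ ∑ℤ f ∣ + ∣ R ∣)       ≤⟨ ℕP.+-monoʳ-≤ ∣ f i ∣ (ℕP.+-monoʳ-≤ ∣ ∑ℤ f ∣ (∣∑f∣≤∑∣f∣ (removeAt f i))) ⟩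
  ∣ f i ∣ + (∣ ∑ℤ f ∣ + ∑ℕ (∣_∣ ∘ removeAt f i))
    ≡⟨ x∙yz≈y∙xz ∣ f i ∣ ∣ ∑ℤ f ∣ _ ⟩
  ∣ ∑ℤ f ∣ + (∣ f i ∣ + ∑ℕ (∣_∣ ∘ removeAt f i))
    ≡⟨ cong (_+_ ∣ ∑ℤ f ∣) (sym (ℕΣ.sum-remove (∣_∣ ∘ f))) ⟩
  ∣ ∑ℤ f ∣ + ∑ℕ (∣_∣ ∘ f)            ∎
  where
  open ℕP.≤-Reasoning
  R : ℤ
  R = ∑ℤ (removeAt f i)

∑ℕ-if≡*countFin : ∀ {n} (b : Fin n → Bool) c → ∑ℕ (λ i → if b i then c else 0) ≡ c * countFin b
∑ℕ-if≡*countFin {zero}  b c = sym (ℕP.*-zeroʳ c)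
∑ℕ-if≡*countFin {suc n} b c with b zero
... | true  = trans (cong (_+_ c) (∑ℕ-if≡*countFin (b ∘ suc) c)) (sym (ℕP.*-suc c _))
... | false = ∑ℕ-if≡*countFin (b ∘ suc) c

anyFin⇒∃ : ∀ {n} (b : Fin n → Bool) → anyFin b ≡ true → ∃ λ i → b i ≡ true
anyFin⇒∃ {suc n} b any with b zero in b₀
... | true  = zero , b₀
... | false = let i , bᵢ = anyFin⇒∃ (b ∘ suc) any in suc i , bᵢ

¬anyFin⇒∀ : ∀ {n} (b : Fin n → Bool) → anyFin b ≡ false → ∀ i → b i ≡ false
¬anyFin⇒∀ {suc n} b none i with b zero in b₀
¬anyFin⇒∀ {suc n} b none zero    | false = b₀
¬anyFin⇒∀ {suc n} b none (suc i) | false = ¬anyFin⇒∀ (b ∘ suc) none i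

∃⇒anyFin : ∀ {n} (b : Fin n → Bool) i → b i ≡ true → anyFin b ≡ true
∃⇒anyFin b zero    bᵢ rewrite bᵢ = refl
∃⇒anyFin b (suc i) bᵢ with b zero
... | true  = refl
... | false = ∃⇒anyFin (b ∘ suc) i bᵢ

countFin-split : ∀ {n} (P Q : Fin n → Bool) → (∀ j → P j ≡ true → Q j ≡ true) →
  countFin Q ≡ countFin P + countFin (λ j → Q j ∧ not (P j))
countFin-split {zero}  P Q P⇒Q = refl
countFin-split {suc n} P Q P⇒Q
  with P zero in p | Q zero in q | countFin-split (P ∘ suc) (Q ∘ suc) (P⇒Q ∘ suc)
... | true  | true  | IH = cong suc IH
... | true  | false | _  with () ← trans (sym (P⇒Q zero p)) q
... | false | true  | IH = trans (cong suc IH) (sym (ℕP.+-suc _ _))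
... | false | false | IH = IH

_↾_ : ∀ {n} → (Fin n → Bool) → (Fin n → ℤ) → Fin n → ℤ
(S ↾ f) i = if S i then f i else 0ℤ

∑-split-↾ : ∀ {n} (S : Fin n → Bool) (f : Fin n → ℤ) → ∑ℤ f ≡ ∑ℤ (S ↾ f) ℤ.+ ∑ℤ ((not ∘ S) ↾ f)
∑-split-↾ S f = trans (ℤΣ.sum-cong-≗ split) (ℤΣ.∑-distrib-+ (S ↾ f) ((not ∘ S) ↾ f))
  where
  split : ∀ i → f i ≡ (S ↾ f) i ℤ.+ ((not ∘ S) ↾ f) i
  split i with S i
  ... | true  = sym (ℤP.+-identityʳ (f i))
  ... | false = sym (ℤP.+-identityˡ (f i))

-- f is the column of one variable in a family of rows, and S marks a subfamily.
NewVariable : ∀ {n} → (Fin n → Bool) → (Fin n → ℤ) → Set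
NewVariable S f = (∀ i → S i ≡ true → f i ≡ 0ℤ) × ∃ λ i → S i ≡ false × f i ≢ 0ℤ

∣∑S↾f∣≤∣∑f∣+∑∣∁S↾f∣ : ∀ {n} (S : Fin n → Bool) (f : Fin n → ℤ) →
  ∣ ∑ℤ (S ↾ f) ∣ ≤ ∣ ∑ℤ f ∣ + ∑ℕ (∣_∣ ∘ ((not ∘ S) ↾ f))
∣∑S↾f∣≤∣∑f∣+∑∣∁S↾f∣ {n} S f = begin
  ∣ ∑ℤ (S ↾ f) ∣                                ≤⟨ ∣i∣≤∣i+j∣+∣j∣ (∑ℤ (S ↾ f)) (∑ℤ g) ⟩
  ∣ ∑ℤ (S ↾ f) ℤ.+ ∑ℤ g ∣ + ∣ ∑ℤ g ∣            ≡⟨ cong (λ x → ∣ x ∣ + ∣ ∑ℤ g ∣) (sym (∑-split-↾ S f)) ⟩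
  ∣ ∑ℤ f ∣ + ∣ ∑ℤ g ∣                          ≤⟨ ℕP.+-monoʳ-≤ ∣ ∑ℤ f ∣ (∣∑f∣≤∑∣f∣ g) ⟩
  ∣ ∑ℤ f ∣ + ∑ℕ (∣_∣ ∘ g)                      ∎
  where
  open ℕP.≤-Reasoning
  g : Fin n → ℤ
  g = (not ∘ S) ↾ f

column-bound : ∀ {n} (S : Fin n → Bool) (f : Fin n → ℤ) (new : Bool) → (new ≡ true → NewVariable S f) →
  ∣ ∑ℤ (S ↾ f) ∣ + (if new then 2 else 0) ≤ ∣ ∑ℤ f ∣ + ∑ℕ (∣_∣ ∘ ((not ∘ S) ↾ f))
column-bound S f false _ = ℕP.≤-trans (ℕP.≤-reflexive (ℕP.+-identityʳ _)) (∣∑S↾f∣≤∣∑f∣+∑∣∁S↾f∣ S f)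
column-bound {n} S f true isNew with isNew refl
... | vanishes , i , i∉S , fᵢ≢0 = begin
  ∣ ∑ℤ (S ↾ f) ∣ + 2        ≡⟨ cong (λ x → ∣ x ∣ + 2) ∑S↾f≡0 ⟩
  2                         ≤⟨ ℕP.*-monoʳ-≤ 2 (ℕP.n≢0⇒n>0 (fᵢ≢0 ∘ ℤP.∣i∣≡0⇒i≡0)) ⟩
  2 * ∣ f i ∣               ≡⟨ cong (λ x → 2 * ∣ x ∣) gᵢ≡fᵢ ⟨
  2 * ∣ g i ∣               ≤⟨ 2∣fᵢ∣≤∣∑f∣+∑∣f∣ g i ⟩
  ∣ ∑ℤ g ∣ + ∑ℕ (∣_∣ ∘ g)   ≡⟨ cong (λ x → ∣ x ∣ + ∑ℕ (∣_∣ ∘ g)) ∑f≡∑g ⟨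
  ∣ ∑ℤ f ∣ + ∑ℕ (∣_∣ ∘ g)   ∎
  where
  open ℕP.≤-Reasoning
  g : Fin n → ℤ
  g = (not ∘ S) ↾ f
  S↾f≗0 : ∀ j → (S ↾ f) j ≡ 0ℤ
  S↾f≗0 j with S j in j∈S
  ... | true  = vanishes j j∈S
  ... | false = refl
  ∑S↾f≡0 : ∑ℤ (S ↾ f) ≡ 0ℤ
  ∑S↾f≡0 = trans (ℤΣ.sum-cong-≗ S↾f≗0) (ℤΣ.sum-replicate-zero n)
  ∑f≡∑g : ∑ℤ f ≡ ∑ℤ g
  ∑f≡∑g = trans (∑-split-↾ S f) (trans (cong (λ x → x ℤ.+ ∑ℤ g) ∑S↾f≡0) (ℤP.+-identityˡ (∑ℤ g)))
  gᵢ≡fᵢ : g i ≡ f i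
  gᵢ≡fᵢ rewrite i∉S = refl

∥_∥₁ : ∀ {k} → (Fin k → ℤ) → ℕ
∥ v ∥₁ = ∑ℕ (∣_∣ ∘ v)

sumRows : ∀ {t k} → (Fin t → Fin k → ℤ) → Fin k → ℤ
sumRows w j = ∑ℤ (λ i → w i j)

restricted-mass-bound : ∀ {t k} (w : Fin t → Fin k → ℤ) (S : Fin t → Bool) (new : Fin k → Bool) →
  (∀ j → new j ≡ true → NewVariable S (λ i → w i j)) →
  ∥ (λ j → ∑ℤ (S ↾ λ i → w i j)) ∥₁ + 2 * countFin new
    ≤ ∥ sumRows w ∥₁ + ∑ℕ (λ i → if not (S i) then ∥ w i ∥₁ else 0)
restricted-mass-bound {t} {k} w S new isNew = begin
  ∥ e′ ∥₁ + 2 * countFin new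
    ≡⟨ cong (_+_ ∥ e′ ∥₁) (sym (∑ℕ-if≡*countFin new 2)) ⟩
  ∥ e′ ∥₁ + ∑ℕ (λ j → if new j then 2 else 0)
    ≡⟨ sym (ℕΣ.∑-distrib-+ (∣_∣ ∘ e′) (λ j → if new j then 2 else 0)) ⟩
  ∑ℕ (λ j → ∣ e′ j ∣ + (if new j then 2 else 0))
    ≤⟨ ∑ℕ-mono-≤ (λ j → column-bound S (column j) (new j) (isNew j)) ⟩
  ∑ℕ (λ j → ∣ sumRows w j ∣ + ∑ℕ (λ i → outside j i))
    ≡⟨ ℕΣ.∑-distrib-+ (λ j → ∣ sumRows w j ∣) (λ j → ∑ℕ (outside j)) ⟩
  ∥ sumRows w ∥₁ + ∑ℕ (λ j → ∑ℕ (λ i → outside j i))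
    ≡⟨ cong (_+_ ∥ sumRows w ∥₁) (ℕΣ.∑-comm outside) ⟩
  ∥ sumRows w ∥₁ + ∑ℕ (λ i → ∑ℕ (λ j → outside j i))
    ≡⟨ cong (_+_ ∥ sumRows w ∥₁) (ℕΣ.sum-cong-≗ row-mass) ⟩
  ∥ sumRows w ∥₁ + ∑ℕ (λ i → if not (S i) then ∥ w i ∥₁ else 0) ∎
  where
  open ℕP.≤-Reasoning
  column : Fin k → Fin t → ℤ
  column j i = w i j
  e′ : Fin k → ℤ
  e′ j = ∑ℤ (S ↾ column j)
  outside : Fin k → Fin t → ℕ
  outside j = ∣_∣ ∘ ((not ∘ S) ↾ column j)
  row-mass : ∀ i → ∑ℕ (λ j → outside j i) ≡ (if not (S i) then ∥ w i ∥₁ else 0)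
  row-mass i with not (S i)
  ... | true  = refl
  ... | false = ℕΣ.sum-replicate-zero k

restricted-small : ∀ {t k} (w : Fin t → Fin k → ℤ) (S : Fin t → Bool) (new : Fin k → Bool) →
  (∀ i → ∥ w i ∥₁ ≤ 4) → ∥ sumRows w ∥₁ ≤ 4 →
  (∀ j → new j ≡ true → NewVariable S (λ i → w i j)) →
  countFin new ≡ 2 * countFin (not ∘ S) →
  ∥ (λ j → ∑ℤ (S ↾ λ i → w i j)) ∥₁ ≤ 4
restricted-small w S new row≤4 sum≤4 isNew #new = ℕP.+-cancelʳ-≤ (4 * c) M 4 (begin
  M + 4 * c                ≡⟨ cong (_+_ M) (trans (ℕP.*-assoc 2 2 c) (cong (_*_ 2) (sym #new))) ⟩
  M + 2 * countFin new     ≤⟨ restricted-mass-bound w S new isNew ⟩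
  ∥ sumRows w ∥₁ + ∑ℕ (λ i → if not (S i) then ∥ w i ∥₁ else 0)
                           ≤⟨ ℕP.+-mono-≤ sum≤4 (∑ℕ-mono-≤ outside≤4) ⟩
  4 + ∑ℕ (λ i → if not (S i) then 4 else 0)
                           ≡⟨ cong (_+_ 4) (∑ℕ-if≡*countFin (not ∘ S) 4) ⟩
  4 + 4 * c                ∎)
  where
  open ℕP.≤-Reasoning
  c M : ℕ
  c = countFin (not ∘ S)
  M = ∥ (λ j → ∑ℤ (S ↾ λ i → w i j)) ∥₁
  outside≤4 : ∀ i → (if not (S i) then ∥ w i ∥₁ else 0) ≤ (if not (S i) then 4 else 0)
  outside≤4 i with not (S i)
  ... | true  = row≤4 i
  ... | false = z≤n

δ : ∀ {k} → Fin k → Fin k → ℕ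
δ a j = if does (a FinP.≟ j) then 1 else 0

∑δ≡1 : ∀ {k} (a : Fin k) → ∑ℕ (δ a) ≡ 1
∑δ≡1 {suc k} zero    = cong suc (ℕΣ.sum-replicate-zero k)
∑δ≡1 {suc k} (suc a) = ∑δ≡1 a

var≡fromℤ∘δ : ∀ {k} (a j : Fin k) → var a j ≡ fromℤ (+ δ a j)
var≡fromℤ∘δ a j with does (a FinP.≟ j)
... | true  = refl
... | false = refl

diff : ∀ {k} → Fin k → Fin k → Fin k → Fin k → Fin k → ℤ
diff a b c d j = (+ δ a j ℤ.- + δ b j) ℤ.- (+ δ c j ℤ.- + δ d j)

IsDiff : ∀ {k} → (Fin k → ℤ) → Set
IsDiff {k} v = ∃ λ (a : Fin k) → ∃ λ b → ∃ λ c → ∃ λ d → ∀ j → v j ≡ diff a b c d j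

SmallBalanced : ∀ {k} → (Fin k → ℤ) → Set
SmallBalanced v = ∑ℤ v ≡ 0ℤ × ∥ v ∥₁ ≤ 4

diff-smallBalanced : ∀ {k} (a b c d : Fin k) → SmallBalanced (diff a b c d)
diff-smallBalanced a b c d = balanced , small
  where
  ∑δ : ∀ a → ∑ℤ (+_ ∘ δ a) ≡ 1ℤ
  ∑δ a = trans (pos-∑ (δ a)) (cong +_ (∑δ≡1 a))
  balanced : ∑ℤ (diff a b c d) ≡ 0ℤ
  balanced = begin
    ∑ℤ (diff a b c d)
      ≡⟨ ∑ℤ-distrib-− (λ j → + δ a j ℤ.- + δ b j) (λ j → + δ c j ℤ.- + δ d j) ⟩
    ∑ℤ (λ j → + δ a j ℤ.- + δ b j) ℤ.- ∑ℤ (λ j → + δ c j ℤ.- + δ d j)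
      ≡⟨ cong₂ ℤ._-_ (∑ℤ-distrib-− (+_ ∘ δ a) (+_ ∘ δ b)) (∑ℤ-distrib-− (+_ ∘ δ c) (+_ ∘ δ d)) ⟩
    (∑ℤ (+_ ∘ δ a) ℤ.- ∑ℤ (+_ ∘ δ b)) ℤ.- (∑ℤ (+_ ∘ δ c) ℤ.- ∑ℤ (+_ ∘ δ d))
      ≡⟨ cong₂ ℤ._-_ (cong₂ ℤ._-_ (∑δ a) (∑δ b)) (cong₂ ℤ._-_ (∑δ c) (∑δ d)) ⟩
    0ℤ ∎
    where open ≡-Reasoning
  ∣diff∣≤ : ∀ j → ∣ diff a b c d j ∣ ≤ (δ a j + δ b j) + (δ c j + δ d j)
  ∣diff∣≤ j = ℕP.≤-trans (ℤP.∣i-j∣≤∣i∣+∣j∣ (+ δ a j ℤ.- + δ b j) (+ δ c j ℤ.- + δ d j))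
    (ℕP.+-mono-≤ (ℤP.∣i-j∣≤∣i∣+∣j∣ (+ δ a j) (+ δ b j)) (ℤP.∣i-j∣≤∣i∣+∣j∣ (+ δ c j) (+ δ d j)))
  small : ∥ diff a b c d ∥₁ ≤ 4
  small = begin
    ∥ diff a b c d ∥₁
      ≤⟨ ∑ℕ-mono-≤ ∣diff∣≤ ⟩
    ∑ℕ (λ j → (δ a j + δ b j) + (δ c j + δ d j))
      ≡⟨ ℕΣ.∑-distrib-+ (λ j → δ a j + δ b j) (λ j → δ c j + δ d j) ⟩
    ∑ℕ (λ j → δ a j + δ b j) + ∑ℕ (λ j → δ c j + δ d j)
      ≡⟨ cong₂ _+_ (ℕΣ.∑-distrib-+ (δ a) (δ b)) (ℕΣ.∑-distrib-+ (δ c) (δ d)) ⟩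
    (∑ℕ (δ a) + ∑ℕ (δ b)) + (∑ℕ (δ c) + ∑ℕ (δ d))
      ≡⟨ cong₂ _+_ (cong₂ _+_ (∑δ≡1 a) (∑δ≡1 b)) (cong₂ _+_ (∑δ≡1 c) (∑δ≡1 d)) ⟩
    4 ∎
    where open ℕP.≤-Reasoning

μ : ∀ {k} → List (Fin k) → Fin k → ℕ
μ []       j = 0
μ (a ∷ as) j = δ a j + μ as j

μ-++ : ∀ {k} (xs ys : List (Fin k)) j → μ (xs ++ ys) j ≡ μ xs j + μ ys j
μ-++ []       ys j = refl
μ-++ (x ∷ xs) ys j = trans (cong (_+_ (δ x j)) (μ-++ xs ys j)) (sym (ℕP.+-assoc (δ x j) _ _))

μ-replicate-here : ∀ {k} n → μ {suc k} (replicate n zero) zero ≡ n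
μ-replicate-here zero    = refl
μ-replicate-here (suc n) = cong suc (μ-replicate-here n)

μ-replicate-there : ∀ {k} n (j : Fin k) → μ (replicate n zero) (suc j) ≡ 0
μ-replicate-there zero    j = refl
μ-replicate-there (suc n) j = μ-replicate-there n j

μ-map-suc-here : ∀ {k} (L : List (Fin k)) → μ (map suc L) zero ≡ 0
μ-map-suc-here []      = refl
μ-map-suc-here (a ∷ L) = μ-map-suc-here L

μ-map-suc-there : ∀ {k} (L : List (Fin k)) j → μ (map suc L) (suc j) ≡ μ L j
μ-map-suc-there []      j = refl
μ-map-suc-there (a ∷ L) j = cong (_+_ (δ a j)) (μ-map-suc-there L j)

copies : ∀ {k} → (Fin k → ℕ) → List (Fin k)
copies {zero}  m = []
copies {suc k} m = replicate (m zero) zero ++ map suc (copies (m ∘ suc))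

μ-copies : ∀ {k} (m : Fin k → ℕ) j → μ (copies m) j ≡ m j
μ-copies {suc k} m zero = begin
  μ (replicate (m zero) zero ++ map suc (copies (m ∘ suc))) zero
    ≡⟨ μ-++ (replicate (m zero) zero) (map suc (copies (m ∘ suc))) zero ⟩
  μ (replicate (m zero) zero) zero + μ (map suc (copies (m ∘ suc))) zero
    ≡⟨ cong₂ _+_ (μ-replicate-here (m zero)) (μ-map-suc-here (copies (m ∘ suc))) ⟩
  m zero + 0
    ≡⟨ ℕP.+-identityʳ (m zero) ⟩
  m zero ∎
  where open ≡-Reasoning
μ-copies {suc k} m (suc j) = begin
  μ (replicate (m zero) zero ++ map suc (copies (m ∘ suc))) (suc j)
    ≡⟨ μ-++ (replicate (m zero) zero) (map suc (copies (m ∘ suc))) (suc j) ⟩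
  μ (replicate (m zero) zero) (suc j) + μ (map suc (copies (m ∘ suc))) (suc j)
    ≡⟨ cong₂ _+_ (μ-replicate-there (m zero) j) (μ-map-suc-there (copies (m ∘ suc)) j) ⟩
  μ (copies (m ∘ suc)) j
    ≡⟨ μ-copies (m ∘ suc) j ⟩
  m (suc j) ∎
  where open ≡-Reasoning

length-copies : ∀ {k} (m : Fin k → ℕ) → length (copies m) ≡ ∑ℕ m
length-copies {zero}  m = refl
length-copies {suc k} m = begin
  length (replicate (m zero) zero ++ map suc (copies (m ∘ suc)))
    ≡⟨ ListP.length-++ (replicate (m zero) zero) ⟩
  length (replicate (m zero) (zero {k})) + length (map suc (copies (m ∘ suc)))
    ≡⟨ cong₂ _+_ (ListP.length-replicate (m zero)) (ListP.length-map suc (copies (m ∘ suc))) ⟩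
  m zero + length (copies (m ∘ suc))
    ≡⟨ cong (_+_ (m zero)) (length-copies (m ∘ suc)) ⟩
  ∑ℕ m ∎
  where open ≡-Reasoning

_⁺ : ℤ → ℕ
(+ n)    ⁺ = n
-[1+ n ] ⁺ = 0

_⁻ : ℤ → ℕ
(+ n)    ⁻ = 0
-[1+ n ] ⁻ = suc n

i≡i⁺−i⁻ : ∀ i → i ≡ + i ⁺ ℤ.- + i ⁻
i≡i⁺−i⁻ (+ n)    = sym (ℤP.+-identityʳ (+ n))
i≡i⁺−i⁻ -[1+ n ] = refl

∣i∣≡i⁺+i⁻ : ∀ i → ∣ i ∣ ≡ i ⁺ + i ⁻
∣i∣≡i⁺+i⁻ (+ n)    = sym (ℕP.+-identityʳ n)
∣i∣≡i⁺+i⁻ -[1+ n ] = refl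

μ−μ⇒IsDiff : ∀ {k} (P Q : List (Fin k)) → length P ≡ length Q → length P + length Q ≤ 4 →
  ¬ (∀ j → + μ P j ℤ.- + μ Q j ≡ 0ℤ) → IsDiff (λ j → + μ P j ℤ.- + μ Q j)
μ−μ⇒IsDiff []                 []                 _  _  ≢0 = ⊥-elim (≢0 (λ _ → refl))
μ−μ⇒IsDiff (a ∷ [])           (b ∷ [])           _  _  _  =
  a , b , a , a , λ j → one-pair (+ δ a j) (+ δ b j)
  where
  one-pair : ∀ x y → (x ℤ.+ 0ℤ) ℤ.- (y ℤ.+ 0ℤ) ≡ (x ℤ.- y) ℤ.- (x ℤ.- x)
  one-pair = ℤSolver.solve-∀
μ−μ⇒IsDiff (a₁ ∷ a₂ ∷ [])      (b₁ ∷ b₂ ∷ [])      _  _  _  =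
  a₁ , b₁ , b₂ , a₂ , λ j → two-pairs (+ δ a₁ j) (+ δ a₂ j) (+ δ b₁ j) (+ δ b₂ j)
  where
  two-pairs : ∀ x₁ x₂ y₁ y₂ →
    (x₁ ℤ.+ (x₂ ℤ.+ 0ℤ)) ℤ.- (y₁ ℤ.+ (y₂ ℤ.+ 0ℤ)) ≡ (x₁ ℤ.- y₁) ℤ.- (y₂ ℤ.- x₂)
  two-pairs = ℤSolver.solve-∀
μ−μ⇒IsDiff (_ ∷ _ ∷ _ ∷ P)     (_ ∷ _ ∷ _ ∷ Q)     _  (s≤s (s≤s (s≤s le))) _
  with ℕP.m+n≤o⇒n≤o (length P) le
... | s≤s ()
μ−μ⇒IsDiff []                 (_ ∷ _)            () _ _
μ−μ⇒IsDiff (_ ∷ _)            []                 () _ _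
μ−μ⇒IsDiff (_ ∷ [])           (_ ∷ _ ∷ _)        () _ _
μ−μ⇒IsDiff (_ ∷ _ ∷ _)        (_ ∷ [])           () _ _
μ−μ⇒IsDiff (_ ∷ _ ∷ [])       (_ ∷ _ ∷ _ ∷ _)    () _ _
μ−μ⇒IsDiff (_ ∷ _ ∷ _ ∷ _)    (_ ∷ _ ∷ [])       () _ _

smallBalanced⇒IsDiff : ∀ {k} (v : Fin k → ℤ) → SmallBalanced v → ¬ (∀ j → v j ≡ 0ℤ) → IsDiff v
smallBalanced⇒IsDiff {k} v (∑v≡0 , ∥v∥≤4) v≢0 =
  let a , b , c , d , μ−μ≡diff = μ−μ⇒IsDiff P Q |P|≡|Q| |P|+|Q|≤4 (λ μ≡0 → v≢0 (λ j → trans (v≡μ−μ j) (μ≡0 j)))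
  in a , b , c , d , λ j → trans (v≡μ−μ j) (μ−μ≡diff j)
  where
  P Q : List (Fin k)
  P = copies (_⁺ ∘ v)
  Q = copies (_⁻ ∘ v)
  v≡μ−μ : ∀ j → v j ≡ + μ P j ℤ.- + μ Q j
  v≡μ−μ j = trans (i≡i⁺−i⁻ (v j))
    (sym (cong₂ (λ x y → + x ℤ.- + y) (μ-copies (_⁺ ∘ v) j) (μ-copies (_⁻ ∘ v) j)))
  ∑⁺−∑⁻≡0 : + ∑ℕ (_⁺ ∘ v) ℤ.- + ∑ℕ (_⁻ ∘ v) ≡ 0ℤ
  ∑⁺−∑⁻≡0 = begin
    + ∑ℕ (_⁺ ∘ v) ℤ.- + ∑ℕ (_⁻ ∘ v)     ≡⟨ sym (cong₂ ℤ._-_ (pos-∑ (_⁺ ∘ v)) (pos-∑ (_⁻ ∘ v))) ⟩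
    ∑ℤ (λ j → + v j ⁺) ℤ.- ∑ℤ (λ j → + v j ⁻) ≡⟨ sym (∑ℤ-distrib-− (λ j → + v j ⁺) (λ j → + v j ⁻)) ⟩
    ∑ℤ (λ j → + v j ⁺ ℤ.- + v j ⁻)      ≡⟨ sym (ℤΣ.sum-cong-≗ (i≡i⁺−i⁻ ∘ v)) ⟩
    ∑ℤ v                                ≡⟨ ∑v≡0 ⟩
    0ℤ                                  ∎
    where open ≡-Reasoning
  |P|≡|Q| : length P ≡ length Q
  |P|≡|Q| = begin
    length P          ≡⟨ length-copies (_⁺ ∘ v) ⟩
    ∑ℕ (_⁺ ∘ v)       ≡⟨ ℤP.+-injective (ℤP.i-j≡0⇒i≡j _ _ ∑⁺−∑⁻≡0) ⟩
    ∑ℕ (_⁻ ∘ v)       ≡⟨ length-copies (_⁻ ∘ v) ⟨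
    length Q          ∎
    where open ≡-Reasoning
  |P|+|Q|≤4 : length P + length Q ≤ 4
  |P|+|Q|≤4 = begin
    length P + length Q              ≡⟨ cong₂ _+_ (length-copies (_⁺ ∘ v)) (length-copies (_⁻ ∘ v)) ⟩
    ∑ℕ (_⁺ ∘ v) + ∑ℕ (_⁻ ∘ v)        ≡⟨ ℕΣ.∑-distrib-+ (_⁺ ∘ v) (_⁻ ∘ v) ⟨
    ∑ℕ (λ j → v j ⁺ + v j ⁻)         ≡⟨ ℕΣ.sum-cong-≗ (∣i∣≡i⁺+i⁻ ∘ v) ⟨
    ∥ v ∥₁                           ≤⟨ ∥v∥≤4 ⟩
    4                                ∎
    where open ℕP.≤-Reasoning

var-diff≡fromℤ∘diff : ∀ {k} (a b c d j : Fin k) →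
  ((var a ⊖ var b) ⊖ (var c ⊖ var d)) j ≡ fromℤ (diff a b c d j)
var-diff≡fromℤ∘diff a b c d j = sym (begin
  fromℤ (diff a b c d j)
    ≡⟨ fromℤ-homo-− (+ δ a j ℤ.- + δ b j) (+ δ c j ℤ.- + δ d j) ⟩
  fromℤ (+ δ a j ℤ.- + δ b j) ℚ.- fromℤ (+ δ c j ℤ.- + δ d j)
    ≡⟨ cong₂ ℚ._-_ (fromℤ-homo-− (+ δ a j) (+ δ b j)) (fromℤ-homo-− (+ δ c j) (+ δ d j)) ⟩
  (fromℤ (+ δ a j) ℚ.- fromℤ (+ δ b j)) ℚ.- (fromℤ (+ δ c j) ℚ.- fromℤ (+ δ d j))
    ≡⟨ sym (cong₂ ℚ._-_ (cong₂ ℚ._-_ (var≡fromℤ∘δ a j) (var≡fromℤ∘δ b j))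
                        (cong₂ ℚ._-_ (var≡fromℤ∘δ c j) (var≡fromℤ∘δ d j))) ⟩
  ((var a ⊖ var b) ⊖ (var c ⊖ var d)) j ∎)
  where open ≡-Reasoning

DiffEq⇒integral : ∀ {k} {f : Form k} → DiffEq f → ∃ λ v → ∀ j → f j ≡ fromℤ (v j)
DiffEq⇒integral (_ , a , b , c , d , f≈) = diff a b c d , λ j → trans (f≈ j) (var-diff≡fromℤ∘diff a b c d j)

DiffEq⇒smallBalanced : ∀ {k} {f : Form k} {v : Fin k → ℤ} → DiffEq f → (∀ j → f j ≡ fromℤ (v j)) →
  SmallBalanced v
DiffEq⇒smallBalanced {v = v} (_ , a , b , c , d , f≈) f≡v =
  trans (ℤΣ.sum-cong-≗ v≗diff) balanced ,
  subst (_≤ 4) (sym (ℕΣ.sum-cong-≗ (cong ∣_∣ ∘ v≗diff))) small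
  where
  balanced : ∑ℤ (diff a b c d) ≡ 0ℤ
  balanced = proj₁ (diff-smallBalanced a b c d)
  small : ∥ diff a b c d ∥₁ ≤ 4
  small = proj₂ (diff-smallBalanced a b c d)
  v≗diff : ∀ j → v j ≡ diff a b c d j
  v≗diff j = fromℤ-injective (trans (sym (f≡v j)) (trans (f≈ j) (var-diff≡fromℤ∘diff a b c d j)))

smallBalanced⇒DiffEq : ∀ {k} {f : Form k} (v : Fin k → ℤ) → (∀ j → f j ≡ fromℤ (v j)) →
  ¬ (f ≈ zeroF) → SmallBalanced v → DiffEq f
smallBalanced⇒DiffEq v f≡v f≉0 sb
  with smallBalanced⇒IsDiff v sb (λ v≗0 → f≉0 (λ j → trans (f≡v j) (cong fromℤ (v≗0 j))))
... | a , b , c , d , v≗diff =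
  f≉0 , a , b , c , d ,
  λ j → trans (f≡v j) (trans (cong fromℤ (v≗diff j)) (sym (var-diff≡fromℤ∘diff a b c d j)))

sumRows-balanced : ∀ {t k} (w : Fin t → Fin k → ℤ) → (∀ i → ∑ℤ (w i) ≡ 0ℤ) → ∑ℤ (sumRows w) ≡ 0ℤ
sumRows-balanced {t} w balanced = begin
  ∑ℤ (λ j → ∑ℤ (λ i → w i j))   ≡⟨ ℤΣ.∑-comm (λ j i → w i j) ⟩
  ∑ℤ (λ i → ∑ℤ (w i))           ≡⟨ ℤΣ.sum-cong-≗ balanced ⟩
  ∑ℤ {t} (λ _ → 0ℤ)             ≡⟨ ℤΣ.sum-replicate-zero t ⟩
  0ℤ                            ∎
  where open ≡-Reasoning

lincomb-integral : ∀ {k t} (l : Fin t → ℚ) (c : Fin t → Form k) {w : Fin t → Fin k → ℤ} →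
  (∀ i j → l i ℚ.* c i j ≡ fromℤ (w i j)) → ∀ j → lincomb l c j ≡ fromℤ (sumRows w j)
lincomb-integral l c {w} lc≡w j = sumFin-fromℤ (λ i → w i j) (λ i → lc≡w i j)

sign : ∀ {q} → (q ≡ 1ℚ) ⊎ (q ≡ - 1ℚ) → ℤ
sign (inj₁ _) = 1ℤ
sign (inj₂ _) = -1ℤ

fromℤ-sign : ∀ {q} (±1 : (q ≡ 1ℚ) ⊎ (q ≡ - 1ℚ)) → q ≡ fromℤ (sign ±1)
fromℤ-sign (inj₁ q≡1)  = q≡1
fromℤ-sign (inj₂ q≡-1) = q≡-1

∣sign*i∣≡∣i∣ : ∀ {q} (±1 : (q ≡ 1ℚ) ⊎ (q ≡ - 1ℚ)) i → ∣ sign ±1 ℤ.* i ∣ ≡ ∣ i ∣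
∣sign*i∣≡∣i∣ (inj₁ _) i = cong ∣_∣ (ℤP.*-identityˡ i)
∣sign*i∣≡∣i∣ (inj₂ _) i = trans (cong ∣_∣ (ℤP.-1*i≡-i i)) (ℤP.∣-i∣≡∣i∣ i)

±1⇒≢0 : ∀ {q} → (q ≡ 1ℚ) ⊎ (q ≡ - 1ℚ) → q ≢ 0ℚ
±1⇒≢0 (inj₁ refl) ()
±1⇒≢0 (inj₂ refl) ()

record SignedRows {k t} (ξ : Fin t → ℚ) (T : Fin t → Form k) : Set where
  field
    row               : Fin t → Fin k → ℤ
    ξT≡row            : ∀ i j → ξ i ℚ.* T i j ≡ fromℤ (row i j)
    row≡0⇒T≡0         : ∀ i j → row i j ≡ 0ℤ → T i j ≡ 0ℚ
    T≡0⇒row≡0         : ∀ i j → T i j ≡ 0ℚ → row i j ≡ 0ℤ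
    row-smallBalanced : ∀ i → SmallBalanced (row i)

signedRows : ∀ {k t} {ξ : Fin t → ℚ} {T : Fin t → Form k} → (∀ i → DiffEq (T i)) →
  (∀ i → (ξ i ≡ 1ℚ) ⊎ (ξ i ≡ - 1ℚ)) → SignedRows ξ T
signedRows {k} {t} {ξ} {T} isDiff ±1 = record
  { row               = row
  ; ξT≡row            = λ i j → trans (cong₂ ℚ._*_ (fromℤ-sign (±1 i)) (T≡z i j)) (sym (fromℤ-homo-* (s i) (z i j)))
  ; row≡0⇒T≡0         = λ i j row≡0 → trans (T≡z i j) (cong fromℤ (ℤP.∣i∣≡0⇒i≡0 (trans (sym (∣row∣≡∣z∣ i j)) (cong ∣_∣ row≡0))))
  ; T≡0⇒row≡0         = λ i j T≡0 → trans (cong (ℤ._*_ (s i)) (fromℤ-injective (trans (sym (T≡z i j)) T≡0))) (ℤP.*-zeroʳ (s i))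
  ; row-smallBalanced = λ i → balanced i , subst (_≤ 4) (sym (ℕΣ.sum-cong-≗ (∣row∣≡∣z∣ i))) (proj₂ (z-smallBalanced i))
  }
  where
  s : Fin t → ℤ
  s i = sign (±1 i)
  z : Fin t → Fin k → ℤ
  z i = proj₁ (DiffEq⇒integral (isDiff i))
  T≡z : ∀ i j → T i j ≡ fromℤ (z i j)
  T≡z i = proj₂ (DiffEq⇒integral (isDiff i))
  z-smallBalanced : ∀ i → SmallBalanced (z i)
  z-smallBalanced i = DiffEq⇒smallBalanced (isDiff i) (T≡z i)
  row : Fin t → Fin k → ℤ
  row i j = s i ℤ.* z i j
  ∣row∣≡∣z∣ : ∀ i j → ∣ row i j ∣ ≡ ∣ z i j ∣
  ∣row∣≡∣z∣ i j = ∣sign*i∣≡∣i∣ (±1 i) (z i j)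
  balanced : ∀ i → ∑ℤ (row i) ≡ 0ℤ
  balanced i = trans (sym (*-distribˡ-sum (s i) (z i))) (trans (cong (ℤ._*_ (s i)) (proj₁ (z-smallBalanced i))) (ℤP.*-zeroʳ (s i)))

containsB≡false⇒≡0 : ∀ {k} (f : Form k) j → containsB f j ≡ false → f j ≡ 0ℚ
containsB≡false⇒≡0 f j notIn with f j ℚP.≟ 0ℚ
... | yes fⱼ≡0 = fⱼ≡0

containsB≡true⇒≢0 : ∀ {k} (f : Form k) j → containsB f j ≡ true → f j ≢ 0ℚ
containsB≡true⇒≢0 f j isIn with f j ℚP.≟ 0ℚ
... | no fⱼ≢0 = fⱼ≢0

numVars≢0⇒Fin : ∀ {k t} (c : Fin t → Form k) → numVars c ≢ 0 → Fin t
numVars≢0⇒Fin {k} {zero}  c #c≢0 = ⊥-elim (#c≢0 (countFin-false k))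
  where
  countFin-false : ∀ k → countFin {k} (λ _ → false) ≡ 0
  countFin-false zero    = refl
  countFin-false (suc k) = countFin-false k
numVars≢0⇒Fin {k} {suc t} c _ = zero

LinIndep⇒lincomb≉0 : ∀ {k t} {c : Fin t → Form k} {l : Fin t → ℚ} → LinIndep c →
  (∀ i → l i ≢ 0ℚ) → Fin t → ¬ (lincomb l c ≈ zeroF)
LinIndep⇒lincomb≉0 {l = l} indep l≢0 i lc≈0 = l≢0 i (indep l lc≈0 i)

newVars : ∀ {k t t'} → (Fin t → Form k) → (Fin t' → Fin t) → Fin k → Bool
newVars T ι j = anyFin (λ i → containsB (T i) j) ∧ not (anyFin (λ i → containsB (T (ι i)) j))

numVars-split : ∀ {k t t'} (T : Fin t → Form k) (ι : Fin t' → Fin t) →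
  numVars T ≡ numVars (T ∘ ι) + countFin (newVars T ι)
numVars-split T ι = countFin-split _ _ inSub⇒inAll
  where
  inSub⇒inAll : ∀ j → anyFin (λ i → containsB (T (ι i)) j) ≡ true → anyFin (λ i → containsB (T i) j) ≡ true
  inSub⇒inAll j inSub = let i , c = anyFin⇒∃ _ inSub in ∃⇒anyFin _ (ι i) c

countFin-newVars : ∀ {k t t'} (T : Fin t → Form k) (ι : Fin t' → Fin t) → t' ≤ t →
  numVars T ≡ 2 * t + 1 → numVars (T ∘ ι) ≡ 2 * t' + 1 → countFin (newVars T ι) ≡ 2 * (t ∸ t')
countFin-newVars {t = t} {t'} T ι t'≤t #T #T∘ι = ℕP.+-cancelˡ-≡ (2 * t' + 1) _ _ (begin
  2 * t' + 1 + countFin (newVars T ι)     ≡⟨ cong (λ n → n + countFin (newVars T ι)) #T∘ι ⟨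
  numVars (T ∘ ι) + countFin (newVars T ι) ≡⟨ numVars-split T ι ⟨
  numVars T                                ≡⟨ #T ⟩
  2 * t + 1                                ≡⟨ cong (λ n → 2 * n + 1) (ℕP.m+[n∸m]≡n t'≤t) ⟨
  2 * (t' + (t ∸ t')) + 1                  ≡⟨ regroup t' (t ∸ t') ⟩
  2 * t' + 1 + 2 * (t ∸ t')                ∎)
  where
  open ≡-Reasoning
  regroup : ∀ m n → 2 * (m + n) + 1 ≡ 2 * m + 1 + 2 * n
  regroup = ℕSolver.solve-∀

prefix : ∀ {t} → ℕ → Fin t → Bool
prefix t' i = toℕ i <ᵇ t'

∑-inject≤ : ∀ {t' t} (t'≤t : t' ≤ t) (f : Fin t → ℤ) → ∑ℤ (λ i → f (inject≤ i t'≤t)) ≡ ∑ℤ (prefix t' ↾ f)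
∑-inject≤ {zero}  {t}     _    f = sym (ℤΣ.sum-replicate-zero t)
∑-inject≤ {suc t'} {suc t} t'≤t f = cong (ℤ._+_ (f zero)) (∑-inject≤ (ℕP.≤-pred t'≤t) (f ∘ suc))

countFin-∁prefix : ∀ {t' t} → t' ≤ t → countFin (not ∘ prefix {t} t') ≡ t ∸ t'
countFin-∁prefix {zero}   {zero}  _    = refl
countFin-∁prefix {zero}   {suc t} _    = cong suc (countFin-∁prefix {zero} {t} z≤n)
countFin-∁prefix {suc t'} {suc t} t'≤t = countFin-∁prefix (ℕP.≤-pred t'≤t)

prefix⇒inject≤ : ∀ {t' t} (t'≤t : t' ≤ t) (i : Fin t) → prefix t' i ≡ true → ∃ λ i' → inject≤ i' t'≤t ≡ i
prefix⇒inject≤ {suc t'} {suc t} t'≤t zero    _     = zero , refl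
prefix⇒inject≤ {suc t'} {suc t} t'≤t (suc i) i<t' =
  let i' , ι≡i = prefix⇒inject≤ (ℕP.≤-pred t'≤t) i i<t' in suc i' , cong suc ι≡i

newVars-prefix : ∀ {k t t'} (T : Fin t → Form k) (t'≤t : t' ≤ t) j →
  newVars T (λ i → inject≤ i t'≤t) j ≡ true →
  (∀ i → prefix t' i ≡ true → T i j ≡ 0ℚ) × ∃ λ i → prefix t' i ≡ false × T i j ≢ 0ℚ
newVars-prefix {t = t} {t'} T t'≤t j new
  with anyFin (λ i → containsB (T i) j) in inAll | anyFin (λ i → containsB (T (inject≤ i t'≤t)) j) in inSub
newVars-prefix T t'≤t j () | false | _
newVars-prefix T t'≤t j () | true  | true
... | true  | false = vanishes , i , ¬-not (λ i∈S → Tᵢⱼ≢0 (vanishes i i∈S)) , Tᵢⱼ≢0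
  where
  vanishes : ∀ i → prefix t' i ≡ true → T i j ≡ 0ℚ
  vanishes i i∈S =
    let i' , ι≡i = prefix⇒inject≤ t'≤t i i∈S
    in subst (λ x → T x j ≡ 0ℚ) ι≡i (containsB≡false⇒≡0 (T (inject≤ i' t'≤t)) j (¬anyFin⇒∀ _ inSub i'))
  occurrence : ∃ λ i → containsB (T i) j ≡ true
  occurrence = anyFin⇒∃ (λ i → containsB (T i) j) inAll
  i : Fin t
  i = proj₁ occurrence
  Tᵢⱼ≢0 : T i j ≢ 0ℚ
  Tᵢⱼ≢0 = containsB≡true⇒≢0 (T i) j (proj₂ occurrence)

newVars⇒NewVariable : ∀ {k t t'} {ξ : Fin t → ℚ} {T : Fin t → Form k} (R : SignedRows ξ T) (t'≤t : t' ≤ t) j →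
  newVars T (λ i → inject≤ i t'≤t) j ≡ true → NewVariable (prefix t') (λ i → SignedRows.row R i j)
newVars⇒NewVariable {T = T} R t'≤t j new =
  let vanishes , i , i∉S , Tᵢⱼ≢0 = newVars-prefix T t'≤t j new
  in (λ i i∈S → T≡0⇒row≡0 i j (vanishes i i∈S)) , i , i∉S , (Tᵢⱼ≢0 ∘ row≡0⇒T≡0 i j)
  where open SignedRows R

lemma5p4 : (k t : ℕ) (T : Fin t → Form k) →
    (∀ i → DiffEq (T i)) → LinIndep T → TwoGood T → TwoFull T →
    (e : Form k) → DiffEq e → MinImplies T e →
    (ξ : Fin t → ℚ) → (∀ i → (ξ i ≡ 1ℚ) ⊎ (ξ i ≡ - 1ℚ)) →
    e ≈ lincomb ξ T →
    (t' : ℕ) (t'≤t : t' ≤ t) →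
    TwoFull (λ i → T (inject≤ i t'≤t)) →
    DiffEq (lincomb (λ i → ξ (inject≤ i t'≤t)) (λ i → T (inject≤ i t'≤t)))
lemma5p4 k t T isDiff _ _ (_ , _ , #T) _ isDiffₑ _ ξ ±1 e≈ξT t' t'≤t (_ , indep′ , #T′) =
  smallBalanced⇒DiffEq e′ (lincomb-integral (ξ ∘ ι) (T ∘ ι) (ξT≡row ∘ ι)) e′≉0 (e′-balanced , e′-small)
  where
  R : SignedRows ξ T
  R = signedRows isDiff ±1
  open SignedRows R
  ι : Fin t' → Fin t
  ι i = inject≤ i t'≤t
  e′ : Fin k → ℤ
  e′ = sumRows (row ∘ ι)
  e′≉0 : ¬ (lincomb (ξ ∘ ι) (T ∘ ι) ≈ zeroF)
  e′≉0 = LinIndep⇒lincomb≉0 indep′ (±1⇒≢0 ∘ ±1 ∘ ι)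
           (numVars≢0⇒Fin (T ∘ ι) (subst (_≢ 0) (sym #T′) (ℕP.m+1+n≢0 (2 * t'))))
  e′-balanced : ∑ℤ e′ ≡ 0ℤ
  e′-balanced = sumRows-balanced (row ∘ ι) (proj₁ ∘ row-smallBalanced ∘ ι)
  e-small : ∥ sumRows row ∥₁ ≤ 4
  e-small = proj₂ (DiffEq⇒smallBalanced isDiffₑ (λ j → trans (e≈ξT j) (lincomb-integral ξ T ξT≡row j)))
  #new : countFin (newVars T ι) ≡ 2 * countFin (not ∘ prefix {t} t')
  #new = trans (countFin-newVars T ι t'≤t #T #T′) (cong (_*_ 2) (sym (countFin-∁prefix t'≤t)))
  e′-small : ∥ e′ ∥₁ ≤ 4
  e′-small = subst (_≤ 4) (ℕΣ.sum-cong-≗ (λ j → cong ∣_∣ (sym (∑-inject≤ t'≤t (λ i → row i j)))))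
    (restricted-small row (prefix t') (newVars T ι) (proj₂ ∘ row-smallBalanced) e-small
      (newVars⇒NewVariable R t'≤t) #new)
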